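{- Let $B$ be a positive integer. If $p$ is an odd prime and $b,c$ are integers with $\left(\frac{b^2+4c}{p}\right)=-1$ and $\left(\frac{ -c}{p}\right)=1$, then $p$ passes the Quadratic Frobenius Test with parameters $(b,c)$.
   Context: Fix a positive integer $B$. Let $n>1$ be odd and let $b,c$ be integers with $\left(\frac{b^2+4c}{n}\right)=-1$ and $\left(\frac{ -c}{n}\right)=1$ (Jacobi symbols). The Quadratic Frobenius Test (QFT) with parameters $(b,c)$ on $n$, with computations in $R=(\mathbb{Z}/n\mathbb{Z})[x]/(x^2-bx-c)$: (1) if $n$ is divisible by a prime $\le\min\{B,\sqrt n\}$, declare composite and stop; (2) if $\sqrt n\in\mathbb{Z}$, declare composite and stop; (3) if $x^{(n+1)/2}\notin\mathbb{Z}/n\mathbb{Z}$ in $R$ (i.e. its reduced form $ux+v$ has $u\ne0$), declare composite and stop; (4) if $x^{n+1}\ne -c$ in $R$, declare composite and stop; (5) writing $n^2-1=2^rs$ with $s$ odd, if $x^s\ne1$ and $x^{2^js}\ne-1$ in $R$ for all $0\le j\le r-2$, declare composite and stop. If $n$ is not declared composite in (1)–(5), $n$ passes the QFT with parameters $(b,c)$. -}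

module Defs where

open import Data.Nat as ℕ using (ℕ; zero; suc; _≤_; _∸_; _^_; NonZero)
open import Data.Nat.DivMod using (_/_; _%_)
open import Data.Nat.Divisibility using (_∣_; _∣?_)
open import Data.Nat.Primality using (Prime)
open import Data.Integer as ℤ using (ℤ; +_; _%ℕ_)
open import Data.Product using (_×_; _,_; proj₁; ∃; Σ)
open import Data.Sum using (_⊎_)
open import Relation.Nullary using (¬_; yes; no)
open import Relation.Binary.PropositionalEquality using (_≡_)
open import Data.Bool using (Bool; true; false; if_then_else_)
open import Data.List using (List; upTo)
open import Data.Bool.ListAction using (any)
open import Relation.Nullary.Decidable using (⌊_⌋)

OddNat : ℕ → Set
OddNat n = n % 2 ≡ 1

-- Reduction of an integer modulo n (result in [0, n)); the n = 0 case is
-- a dummy value and never used (the statement only uses n prime).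

modn : ℕ → ℤ → ℕ
modn zero    a = 0
modn (suc k) a = a %ℕ suc k

isSquareMod : ℤ → ℕ → Bool
isSquareMod a q = any (λ x → ⌊ modn q (+ (x ℕ.* x)) ℕ.≟ modn q a ⌋) (upTo q)

legendre : ℤ → ℕ → ℤ
legendre a q with modn q a ℕ.≟ 0
... | yes _ = + 0
... | no  _ = if isSquareMod a q then + 1 else ℤ.-[1+ 0 ]

spfFrom : ℕ → ℕ → ℕ → ℕ   -- fuel, candidate d, n
spfFrom zero    d n = n
spfFrom (suc f) d n with d ∣? n
... | yes _ = d
... | no  _ = spfFrom f (suc d) n

spf : ℕ → ℕ
spf n = spfFrom n 2 n

-- Jacobi symbol (a / n) for odd n ≥ 1: the product of the Legendre
-- symbols (a / q) over the prime factorisation n = ∏ q (with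
-- multiplicity).

jacobiFuel : ℕ → ℤ → ℕ → ℤ
jacobiFuel zero    a n = + 1
jacobiFuel (suc f) a n with n ℕ.≤? 1
... | yes _ = + 1
... | no  _ with spf n
...   | zero  = + 1                      -- impossible for n ≥ 2
...   | suc q = legendre a (suc q) ℤ.* jacobiFuel f a (n / suc q)

jacobi : ℤ → ℕ → ℤ
jacobi a n = jacobiFuel n a n

-- The ring R = (ℤ/nℤ)[x]/(x² - b x - c).  An element u x + v is stored
-- as the pair (u , v) of residues in [0, n).

R : Set
R = ℕ × ℕ

-- (u₁x+v₁)(u₂x+v₂) = u₁u₂ x² + (u₁v₂+u₂v₁) x + v₁v₂, with x² = b x + c.
mulR : ℕ → ℤ → ℤ → R → R → R
mulR n b c (u₁ , v₁) (u₂ , v₂) =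
  modn n (b ℤ.* (+ (u₁ ℕ.* u₂)) ℤ.+ + (u₁ ℕ.* v₂ ℕ.+ u₂ ℕ.* v₁)) ,
  modn n (c ℤ.* (+ (u₁ ℕ.* u₂)) ℤ.+ + (v₁ ℕ.* v₂))

oneR : ℕ → R
oneR n = 0 , modn n (+ 1)

xR : ℕ → R
xR n = modn n (+ 1) , 0

constR : ℕ → ℤ → R
constR n a = 0 , modn n a

xpow : ℕ → ℤ → ℤ → ℕ → R
xpow n b c zero    = oneR n
xpow n b c (suc k) = mulR n b c (xR n) (xpow n b c k)

-- (1) n divisible by a prime q ≤ min{B, √n}  (q ≤ √n ⇔ q² ≤ n)
Step1Composite : ℕ → ℕ → Set
Step1Composite B n = ∃ λ q → Prime q × q ≤ B × q ℕ.* q ≤ n × q ∣ n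

Step2Composite : ℕ → Set
Step2Composite n = ∃ λ m → m ℕ.* m ≡ n

Step3Composite : ℕ → ℤ → ℤ → Set
Step3Composite n b c = ¬ (proj₁ (xpow n b c ((n ℕ.+ 1) / 2)) ≡ 0)

Step4Composite : ℕ → ℤ → ℤ → Set
Step4Composite n b c = ¬ (xpow n b c (n ℕ.+ 1) ≡ constR n (ℤ.- c))

Step5Composite : ℕ → ℤ → ℤ → Set
Step5Composite n b c =
  Σ ℕ λ r → Σ ℕ λ s → (n ℕ.* n ∸ 1 ≡ 2 ^ r ℕ.* s) × OddNat s ×
    ¬ (xpow n b c s ≡ oneR n) ×
    (∀ j → j ℕ.+ 2 ≤ r → ¬ (xpow n b c (2 ^ j ℕ.* s) ≡ constR n (ℤ.- (+ 1))))

PassesQFT : ℕ → ℕ → ℤ → ℤ → Set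
PassesQFT B n b c =
  ¬ Step1Composite B n × ¬ Step2Composite n × ¬ Step3Composite n b c ×
  ¬ Step4Composite n b c × ¬ Step5Composite n b c

-- Let p = 2m + 1 and R = 𝔽ₚ[x]/(x² − b x − c).  As R has characteristic p, y ↦ yᵖ is additive
-- (freshman's dream) and fixes 𝔽ₚ (Fermat).  Euler's criterion gives Dᵐ = −1 for the non-square
-- D = b² + 4c (otherwise tᵐ − 1 would have the m + 1 roots D, 1², …, m², against Lagrange's bound),
-- so (2x − b)ᵖ = (2x − b)·Dᵐ = −(2x − b); hence xᵖ = b − x and x^(p+1) = x(b − x) = −c.  Since D is
-- not a square, the norm v² + b u v − c u² of u x + v is anisotropic and R is a field.  Writing
-- −c = e² with e ≠ 0, the element x^((p+1)/2) squares to e², so it is ±e ∈ 𝔽ₚ: this is step (3).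
-- Moreover x^((p²−1)/2) = (−c)ᵐ = e^(p−1) = 1, and taking square roots in the field R from there
-- gives step (5).  Steps (1) and (2) never declare a prime composite.

module Submission where

open import Algebra.Bundles using (CommutativeRing; CommutativeSemiring)
open import Data.Nat as ℕ using (ℕ; suc)
open import Data.Nat.Primality using (Prime)
open import Data.Integer as ℤ using (ℤ)
open import Relation.Nullary using (¬_; contradiction)

module DomainProperties {c ℓ} (R : CommutativeRing c ℓ) where

  open CommutativeRing R
  open import Level using (_⊔_)
  open import Data.Sum using (_⊎_; map; fromInj₁; fromInj₂)
  open import Algebra.Properties.Ring ring
    using ([y-z]x≈yx-zx; x[y-z]≈xy-xz; x∙y⁻¹≈ε⇒x≈y; x≈y⇒x∙y⁻¹≈ε; +-inverseˡ-unique)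
  open import Algebra.Properties.Semiring.Exp semiring using (_^_; ^-homo-*; ^-congʳ)
  open import Relation.Binary.Reasoning.Setoid setoid
  open import Data.Nat as ℕ using (zero)
  import Data.Nat.Properties as ℕ
  open import Relation.Binary.PropositionalEquality using (cong)

  NoZeroDivisors : Set (c ⊔ ℓ)
  NoZeroDivisors = ∀ x y → x * y ≈ 0# → x ≈ 0# ⊎ y ≈ 0#

  [x-y][x+y]≈x*x-y*y : ∀ x y → (x - y) * (x + y) ≈ x * x - y * y
  [x-y][x+y]≈x*x-y*y x y = begin
    (x - y) * (x + y)                      ≈⟨ distribˡ (x - y) x y ⟩
    (x - y) * x + (x - y) * y              ≈⟨ +-cong ([y-z]x≈yx-zx x x y) ([y-z]x≈yx-zx y x y) ⟩
    (x * x - y * x) + (x * y - y * y)      ≈⟨ +-assoc (x * x) (- (y * x)) (x * y - y * y) ⟩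
    x * x + (- (y * x) + (x * y - y * y))  ≈⟨ +-congˡ (+-assoc (- (y * x)) (x * y) (- (y * y))) ⟨
    x * x + ((- (y * x) + x * y) - y * y)  ≈⟨ +-congˡ (+-congʳ (+-congˡ (*-comm x y))) ⟩
    x * x + ((- (y * x) + y * x) - y * y)  ≈⟨ +-congˡ (+-congʳ (-‿inverseˡ (y * x))) ⟩
    x * x + (0# - y * y)                   ≈⟨ +-congˡ (+-identityˡ (- (y * y))) ⟩
    x * x - y * y                          ∎

  module _ (noZeroDivisors : NoZeroDivisors) where

    x*x≈y*y⇒x≈y⊎x≈-y : ∀ {x y} → x * x ≈ y * y → x ≈ y ⊎ x ≈ - y
    x*x≈y*y⇒x≈y⊎x≈-y {x} {y} x²≈y² =
      map (x∙y⁻¹≈ε⇒x≈y x y) (+-inverseˡ-unique x y) (noZeroDivisors (x - y) (x + y) [x-y][x+y]≈0)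
      where
      [x-y][x+y]≈0 : (x - y) * (x + y) ≈ 0#
      [x-y][x+y]≈0 = trans ([x-y][x+y]≈x*x-y*y x y) (x≈y⇒x∙y⁻¹≈ε x²≈y²)

    *-cancelˡ : ∀ {x y z} → ¬ x ≈ 0# → x * y ≈ x * z → y ≈ z
    *-cancelˡ {x} {y} {z} x≉0 xy≈xz =
      x∙y⁻¹≈ε⇒x≈y y z (fromInj₂ (λ x≈0 → contradiction x≈0 x≉0) (noZeroDivisors x (y - z) x[y-z]≈0))
      where
      x[y-z]≈0 : x * (y - z) ≈ 0#
      x[y-z]≈0 = trans (x[y-z]≈xy-xz x y z) (x≈y⇒x∙y⁻¹≈ε xy≈xz)

    x*x≈1⇒x≈1⊎x≈-1 : ∀ {x} → x * x ≈ 1# → x ≈ 1# ⊎ x ≈ - 1#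
    x*x≈1⇒x≈1⊎x≈-1 x*x≈1 = x*x≈y*y⇒x≈y⊎x≈-y (trans x*x≈1 (sym (*-identityˡ 1#)))

    x^2^r≈1⇒x≈1 : ∀ r {x} → x ^ (2 ℕ.^ r) ≈ 1# → (∀ j → j ℕ.< r → ¬ x ^ (2 ℕ.^ j) ≈ - 1#) → x ≈ 1#
    x^2^r≈1⇒x≈1 zero {x} x≈1 _ = trans (sym (*-identityʳ x)) x≈1
    x^2^r≈1⇒x≈1 (suc r) {x} x^2^[1+r]≈1 x^2^j≉-1 =
      x^2^r≈1⇒x≈1 r (fromInj₁ (λ y≈-1 → contradiction y≈-1 (x^2^j≉-1 r ℕ.≤-refl)) (x*x≈1⇒x≈1⊎x≈-1 y*y≈1))
                    (λ j j<r → x^2^j≉-1 j (ℕ.m<n⇒m<1+n j<r))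
      where
      y = x ^ (2 ℕ.^ r)
      y*y≈1 : y * y ≈ 1#
      y*y≈1 = begin
        y * y                             ≈⟨ ^-homo-* x (2 ℕ.^ r) (2 ℕ.^ r) ⟨
        x ^ (2 ℕ.^ r ℕ.+ 2 ℕ.^ r)         ≈⟨ ^-congʳ x (cong (2 ℕ.^ r ℕ.+_) (ℕ.+-identityʳ (2 ℕ.^ r))) ⟨
        x ^ (2 ℕ.^ suc r)                 ≈⟨ x^2^[1+r]≈1 ⟩
        1#                                ∎

module PrimeBinomial where

  open import Data.Nat
  open import Data.Nat.Properties
  open import Data.Nat.Divisibility
  open import Data.Nat.DivMod using (m/n*n≡m)
  open import Data.Nat.Combinatorics using (_C_; nCk≡n!/k![n-k]!; k![n∸k]!∣n!)
  open import Data.Nat.Primality using (euclidsLemma; prime⇒nonTrivial)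
  open import Data.Sum using (inj₁; inj₂; [_,_]′; fromInj₁)
  open import Relation.Binary.PropositionalEquality

  nCk*[k!*[n∸k]!]≡n! : ∀ {n k} → k ≤ n → (n C k) * (k ! * (n ∸ k) !) ≡ n !
  nCk*[k!*[n∸k]!]≡n! {n} {k} k≤n = begin
    (n C k) * (k ! * (n ∸ k) !)                    ≡⟨ cong (_* (k ! * (n ∸ k) !)) (nCk≡n!/k![n-k]! k≤n) ⟩
    (n ! / (k ! * (n ∸ k) !)) * (k ! * (n ∸ k) !)  ≡⟨ m/n*n≡m (k![n∸k]!∣n! k≤n) ⟩
    n !                                            ∎
    where
    open ≡-Reasoning
    instance _ = k !* (n ∸ k) !≢0

  p∤k! : ∀ {p k} → Prime p → k < p → ¬ p ∣ k !
  p∤k! {k = zero}  p-prime _   p∣1 = nonTrivial⇒≢1 {{prime⇒nonTrivial p-prime}} (∣1⇒≡1 p∣1)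
  p∤k! {k = suc k} p-prime k<p p∣k! with euclidsLemma (suc k) (k !) p-prime p∣k!
  ... | inj₁ p∣1+k = <⇒≱ k<p (∣⇒≤ p∣1+k)
  ... | inj₂ p∣k!  = p∤k! p-prime (<-trans (n<1+n k) k<p) p∣k!

  p∣pCk : ∀ {p k} → Prime p → 0 < k → k < p → p ∣ p C k
  p∣pCk {p@(suc p-1)} {k} p-prime 0<k k<p =
    fromInj₁ (λ p∣k!*[p∸k]! → contradiction p∣k!*[p∸k]! p∤k!*[p∸k]!)
             (euclidsLemma (p C k) (k ! * (p ∸ k) !) p-prime p∣pCk*[k!*[p∸k]!])
    where
    p∣pCk*[k!*[p∸k]!] : p ∣ (p C k) * (k ! * (p ∸ k) !)
    p∣pCk*[k!*[p∸k]!] = subst (p ∣_) (sym (nCk*[k!*[n∸k]!]≡n! (<⇒≤ k<p))) (m∣m*n (p-1 !))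
    p∤k!*[p∸k]! : ¬ p ∣ k ! * (p ∸ k) !
    p∤k!*[p∸k]! p∣k!*[p∸k]! =
      [ p∤k! p-prime k<p , p∤k! p-prime (∸-monoʳ-< 0<k (<⇒≤ k<p)) ]′ (euclidsLemma (k !) ((p ∸ k) !) p-prime p∣k!*[p∸k]!)

module FreshmansDream {c ℓ} (S : CommutativeSemiring c ℓ) where

  open CommutativeSemiring S hiding (zero)
  open import Data.Nat as ℕ using (z<s; s<s)
  open import Data.Nat.Properties using (n∸n≡0)
  open import Data.Nat.Divisibility using (_∣_; divides)
  open import Data.Nat.Combinatorics using (_C_; nCn≡1)
  open import Data.Fin using (zero; suc; fromℕ; inject₁)
  open import Data.Fin.Properties using (toℕ-fromℕ; inject₁ℕ<)
  open import Algebra.Properties.Semiring.Exp semiring using (_^_)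
  open import Algebra.Properties.Semiring.Mult semiring using (_×_; ×-congʳ; ×-assoc-*)
  open import Algebra.Properties.Monoid.Mult +-monoid using (×-assocˡ)
  open import Algebra.Properties.Monoid.Sum +-monoid
    using (sum; sum-cong-≋; sum-replicate; sum-replicate-zero; sum-init-last)
  open import Algebra.Properties.CommutativeSemiring.Binomial S using (theorem; binomialTerm)
  open import Relation.Binary.PropositionalEquality as ≡ using (_≡_)
  open import Relation.Binary.Reasoning.Setoid setoid
  open PrimeBinomial using (p∣pCk)

  p∣n⇒n×x≈0 : ∀ {p n} → p × 1# ≈ 0# → ∀ x → p ∣ n → n × x ≈ 0#
  p∣n⇒n×x≈0 {p} p×1≈0 x (divides q ≡.refl) = begin
    (q ℕ.* p) × x       ≈⟨ ×-assocˡ x q p ⟨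
    q × (p × x)         ≈⟨ ×-congʳ q p×x≈0 ⟩
    q × 0#              ≈⟨ sum-replicate q ⟨
    sum {q} (λ _ → 0#)  ≈⟨ sum-replicate-zero q ⟩
    0#                  ∎
    where
    p×x≈0 : p × x ≈ 0#
    p×x≈0 = begin
      p × x         ≈⟨ ×-congʳ p (*-identityˡ x) ⟨
      p × (1# * x)  ≈⟨ ×-assoc-* p 1# x ⟨
      (p × 1#) * x  ≈⟨ *-congʳ p×1≈0 ⟩
      0# * x        ≈⟨ zeroˡ x ⟩
      0#            ∎

  freshman's-dream : ∀ {p} → Prime p → p × 1# ≈ 0# → ∀ x y → (x + y) ^ p ≈ x ^ p + y ^ p
  freshman's-dream {suc k} p-prime p×1≈0 x y = begin
    (x + y) ^ p                                                        ≈⟨ theorem p x y ⟩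
    t zero + sum (λ i → t (suc i))                                     ≈⟨ +-congˡ (sum-init-last (λ i → t (suc i))) ⟩
    t zero + (sum (λ i → t (suc (inject₁ i))) + t (suc (fromℕ k)))     ≈⟨ +-cong t₀≈y^p (+-cong (sum-cong-≋ tᵢ≈0) tₚ≈x^p) ⟩
    y ^ p + (sum {k} (λ _ → 0#) + x ^ p)                               ≈⟨ +-congˡ (+-congʳ (sum-replicate-zero k)) ⟩
    y ^ p + (0# + x ^ p)                                               ≈⟨ +-congˡ (+-identityˡ (x ^ p)) ⟩
    y ^ p + x ^ p                                                      ≈⟨ +-comm (y ^ p) (x ^ p) ⟩
    x ^ p + y ^ p                                                      ∎
    where
    p = suc k
    t = binomialTerm x y p
    t₀≈y^p : t zero ≈ y ^ p
    t₀≈y^p = trans (+-identityʳ _) (*-identityˡ _)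
    tᵢ≈0 : ∀ i → t (suc (inject₁ i)) ≈ 0#
    tᵢ≈0 i = p∣n⇒n×x≈0 p×1≈0 _ (p∣pCk p-prime z<s (s<s (inject₁ℕ< i)))
    tₚ≈x^p : t (suc (fromℕ k)) ≈ x ^ p
    tₚ≈x^p = top (toℕ-fromℕ k)
      where
      top : ∀ {j} → j ≡ k → (p C suc j) × (x ^ suc j * y ^ (p ℕ.∸ suc j)) ≈ x ^ p
      top ≡.refl rewrite nCn≡1 p | n∸n≡0 k = trans (+-identityʳ _) (*-identityʳ _)

module IntegersModulo where

  open import Data.Nat as ℕ using (zero; _<_)
  import Data.Nat.Properties as ℕ
  import Data.Nat.Divisibility as ℕ
  open import Data.Integer using (+_; 0ℤ; 1ℤ; ∣_∣; _+_; _*_; -_; _-_; _%ℕ_; _/ℕ_)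
  import Data.Integer.Properties as ℤ
  open import Data.Integer.DivMod using (a≡a%ℕn+[a/ℕn]*n; n%ℕd<d)
  open import Relation.Nullary using (Dec)
  import Relation.Nullary.Decidable as Dec
  open import Data.Integer.Divisibility.Signed using (_∣_; divides; ∣-refl; ∣⇒∣ᵤ; ∣m∣n⇒∣m+n; ∣m⇒∣-m; ∣n⇒∣m*n)
  open import Data.Integer.Tactic.RingSolver using (solve-∀)
  open import Data.Product using (∃; _,_)
  open import Level using (0ℓ)
  open import Relation.Binary.Structures using (IsEquivalence)
  open import Relation.Binary.PropositionalEquality
  open import Defs using (modn)

  infix 4 _≡_mod_
  record _≡_mod_ (a b : ℤ) (n : ℕ) : Set where
    constructor ∣⇒≡mod
    field ≡mod⇒∣ : + n ∣ a - b
  open _≡_mod_ public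

  module _ {n : ℕ} where

    ≡⇒≡mod : ∀ {a b} → a ≡ b → a ≡ b mod n
    ≡⇒≡mod {a} refl = ∣⇒≡mod (divides 0ℤ (trans (ℤ.+-inverseʳ a) (sym (ℤ.*-zeroˡ (+ n)))))

    ≡mod-sym : ∀ {a b} → a ≡ b mod n → b ≡ a mod n
    ≡mod-sym {a} {b} (∣⇒≡mod n∣a-b) = ∣⇒≡mod (subst (+ n ∣_) (lemma a b) (∣m⇒∣-m n∣a-b))
      where
      lemma : ∀ a b → - (a - b) ≡ b - a
      lemma = solve-∀

    ≡mod-trans : ∀ {a b c} → a ≡ b mod n → b ≡ c mod n → a ≡ c mod n
    ≡mod-trans {a} {b} {c} (∣⇒≡mod n∣a-b) (∣⇒≡mod n∣b-c) =
      ∣⇒≡mod (subst (+ n ∣_) (lemma a b c) (∣m∣n⇒∣m+n n∣a-b n∣b-c))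
      where
      lemma : ∀ a b c → (a - b) + (b - c) ≡ a - c
      lemma = solve-∀

    ≡mod-isEquivalence : IsEquivalence (λ a b → a ≡ b mod n)
    ≡mod-isEquivalence = record { refl = ≡⇒≡mod refl ; sym = ≡mod-sym ; trans = ≡mod-trans }

    +-cong-mod : ∀ {a b c d} → a ≡ b mod n → c ≡ d mod n → a + c ≡ b + d mod n
    +-cong-mod {a} {b} {c} {d} (∣⇒≡mod n∣a-b) (∣⇒≡mod n∣c-d) =
      ∣⇒≡mod (subst (+ n ∣_) (lemma a b c d) (∣m∣n⇒∣m+n n∣a-b n∣c-d))
      where
      lemma : ∀ a b c d → (a - b) + (c - d) ≡ (a + c) - (b + d)
      lemma = solve-∀

    *-cong-mod : ∀ {a b c d} → a ≡ b mod n → c ≡ d mod n → a * c ≡ b * d mod n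
    *-cong-mod {a} {b} {c} {d} (∣⇒≡mod n∣a-b) (∣⇒≡mod n∣c-d) =
      ∣⇒≡mod (subst (+ n ∣_) (lemma a b c d) (∣m∣n⇒∣m+n (∣n⇒∣m*n c n∣a-b) (∣n⇒∣m*n b n∣c-d)))
      where
      lemma : ∀ a b c d → c * (a - b) + b * (c - d) ≡ a * c - b * d
      lemma = solve-∀

    -‿cong-mod : ∀ {a b} → a ≡ b mod n → - a ≡ - b mod n
    -‿cong-mod {a} {b} (∣⇒≡mod n∣a-b) = ∣⇒≡mod (subst (+ n ∣_) (lemma a b) (∣m⇒∣-m n∣a-b))
      where
      lemma : ∀ a b → - (a - b) ≡ - a - - b
      lemma = solve-∀

  ℤ/_ℤ : ℕ → CommutativeRing 0ℓ 0ℓ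
  ℤ/ n ℤ = record
    { Carrier = ℤ
    ; _≈_ = λ a b → a ≡ b mod n
    ; _+_ = _+_
    ; _*_ = _*_
    ; -_ = -_
    ; 0# = 0ℤ
    ; 1# = + 1
    ; isCommutativeRing = record
      { isRing = record
        { +-isAbelianGroup = record
          { isGroup = record
            { isMonoid = record
              { isSemigroup = record
                { isMagma = record { isEquivalence = ≡mod-isEquivalence ; ∙-cong = +-cong-mod }
                ; assoc = λ x y z → ≡⇒≡mod (ℤ.+-assoc x y z)
                }
              ; identity = (λ x → ≡⇒≡mod (ℤ.+-identityˡ x)) , (λ x → ≡⇒≡mod (ℤ.+-identityʳ x))
              }
            ; inverse = (λ x → ≡⇒≡mod (ℤ.+-inverseˡ x)) , (λ x → ≡⇒≡mod (ℤ.+-inverseʳ x))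
            ; ⁻¹-cong = -‿cong-mod
            }
          ; comm = λ x y → ≡⇒≡mod (ℤ.+-comm x y)
          }
        ; *-cong = *-cong-mod
        ; *-assoc = λ x y z → ≡⇒≡mod (ℤ.*-assoc x y z)
        ; *-identity = (λ x → ≡⇒≡mod (ℤ.*-identityˡ x)) , (λ x → ≡⇒≡mod (ℤ.*-identityʳ x))
        ; distrib = (λ x y z → ≡⇒≡mod (ℤ.*-distribˡ-+ x y z)) , (λ x y z → ≡⇒≡mod (ℤ.*-distribʳ-+ x y z))
        }
      ; *-comm = λ x y → ≡⇒≡mod (ℤ.*-comm x y)
      }
    }

  module _ {n : ℕ} where

    ∣⇒≡0mod : ∀ {a} → + n ∣ a → a ≡ 0ℤ mod n
    ∣⇒≡0mod {a} n∣a = ∣⇒≡mod (subst (+ n ∣_) (sym (ℤ.+-identityʳ a)) n∣a)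

    ≡0mod⇒∣ : ∀ {a} → a ≡ 0ℤ mod n → + n ∣ a
    ≡0mod⇒∣ {a} (∣⇒≡mod n∣a-0) = subst (+ n ∣_) (ℤ.+-identityʳ a) n∣a-0

  module _ (n : ℕ) where

    open import Algebra.Properties.Semiring.Mult (CommutativeRing.semiring ℤ/ n ℤ) using (_×_)

    n≡0 : + n ≡ 0ℤ mod n
    n≡0 = ∣⇒≡0mod ∣-refl

    characteristic : n × 1ℤ ≡ 0ℤ mod n
    characteristic = ≡mod-trans (≡⇒≡mod (k×1≡k n)) n≡0
      where
      k×1≡k : ∀ k → k × 1ℤ ≡ + k
      k×1≡k zero    = refl
      k×1≡k (suc k) = cong (_+_ 1ℤ) (k×1≡k k)

  SquareMod : ℕ → ℤ → Set
  SquareMod n a = ∃ λ t → a ≡ t * t mod n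

  module Residues (k : ℕ) where

    private
      n = suc k

    modn≡mod : ∀ a → + modn n a ≡ a mod n
    modn≡mod a = ≡mod-sym (∣⇒≡mod (divides (a /ℕ n) (begin
      a - + r                  ≡⟨ cong (_- + r) (a≡a%ℕn+[a/ℕn]*n a n) ⟩
      (+ r + q * + n) - + r    ≡⟨ lemma (+ r) q (+ n) ⟩
      q * + n                  ∎)))
      where
      open ≡-Reasoning
      r = a %ℕ n
      q = a /ℕ n
      lemma : ∀ r q n → (r + q * n) - r ≡ q * n
      lemma = solve-∀

    residue-injective : ∀ {r s} → r < n → s < n → + r ≡ + s mod n → r ≡ s
    residue-injective {r} {s} r<n s<n (∣⇒≡mod n∣r-s) =
      ℤ.+-injective (ℤ.i-j≡0⇒i≡j (+ r) (+ s) (ℤ.∣i∣≡0⇒i≡0 d≡0))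
      where
      d = ∣ + r - + s ∣
      d<n : d < n
      d<n = ℕ.≤-<-trans (ℕ.≤-reflexive (cong ∣_∣ (ℤ.m-n≡m⊖n r s)))
                        (ℕ.≤-<-trans (ℤ.∣m⊝n∣≤m⊔n r s) (ℕ.⊔-pres-<m r<n s<n))
      d≡0 : d ≡ 0
      d≡0 with d in eq
      ... | zero  = refl
      ... | suc _ = contradiction (subst (n ℕ.∣_) eq (∣⇒∣ᵤ n∣r-s)) (ℕ.>⇒∤ (subst (_< n) eq d<n))

    ≡mod⇒modn≡ : ∀ {a b} → a ≡ b mod n → modn n a ≡ modn n b
    ≡mod⇒modn≡ {a} {b} a≡b = residue-injective (n%ℕd<d a n) (n%ℕd<d b n)
      (≡mod-trans (modn≡mod a) (≡mod-trans a≡b (≡mod-sym (modn≡mod b))))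

    modn≡⇒≡mod : ∀ {a b} → modn n a ≡ modn n b → a ≡ b mod n
    modn≡⇒≡mod {a} {b} eq =
      ≡mod-trans (≡mod-sym (modn≡mod a)) (subst (λ r → + r ≡ b mod n) (sym eq) (modn≡mod b))

    ≡mod-dec : ∀ a b → Dec (a ≡ b mod n)
    ≡mod-dec a b = Dec.map′ modn≡⇒≡mod ≡mod⇒modn≡ (modn n a ℕ.≟ modn n b)

module IntegerPolynomials where

  open import Data.Nat using (zero)
  open import Data.Integer using (0ℤ; _+_; _*_; _-_)
  open import Data.Integer.Tactic.RingSolver using (solve-∀)
  open import Data.Product using (∃; _×_; _,_)
  open import Relation.Binary.PropositionalEquality

  data DegreeBelow : ℕ → (ℤ → ℤ) → Set where
    vanishing : ∀ {f} → (∀ t → f t ≡ 0ℤ) → DegreeBelow zero f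
    horner    : ∀ {n f} a g → DegreeBelow n g → (∀ t → f t ≡ a + t * g t) → DegreeBelow (suc n) f

  +-const : ∀ {n f} → DegreeBelow (suc n) f → ∀ c → DegreeBelow (suc n) (λ t → f t + c)
  +-const (horner a g g-poly f≡a+tg) c = horner (a + c) g g-poly λ t → trans (cong (_+ c) (f≡a+tg t)) (lemma a (t * g t) c)
    where
    lemma : ∀ a x c → (a + x) + c ≡ (a + c) + x
    lemma = solve-∀

  factor-theorem : ∀ {n f} → DegreeBelow (suc n) f → ∀ r →
                   ∃ λ q → DegreeBelow n q × (∀ t → f t ≡ f r + (t - r) * q t)
  factor-theorem {f = f} (horner a g (vanishing g≡0) f≡a+tg) r = (λ _ → 0ℤ) , vanishing (λ _ → refl) , f≡fr
    where
    f≡fr : ∀ t → f t ≡ f r + (t - r) * 0ℤ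
    f≡fr t rewrite f≡a+tg t | f≡a+tg r | g≡0 t | g≡0 r = lemma a t r
      where
      lemma : ∀ a t r → a + t * 0ℤ ≡ (a + r * 0ℤ) + (t - r) * 0ℤ
      lemma = solve-∀
  factor-theorem {f = f} (horner a g g-poly@(horner _ _ _ _) f≡a+tg) r
    with factor-theorem g-poly r
  ... | q , q-poly , g≡gr+[t-r]q = (λ t → g r + t * q t) , horner (g r) q q-poly (λ _ → refl) , f≡fr
    where
    f≡fr : ∀ t → f t ≡ f r + (t - r) * (g r + t * q t)
    f≡fr t rewrite f≡a+tg t | f≡a+tg r | g≡gr+[t-r]q t = lemma a t r (g r) (q t)
      where
      lemma : ∀ a t r G Q → a + t * (G + (t - r) * Q) ≡ (a + r * G) + (t - r) * (G + t * Q)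
      lemma = solve-∀

module PrimeModulus (k : ℕ) (p-prime : Prime (suc k)) where

  open import Data.Nat as ℕ using (zero)
  open import Data.Nat.Divisibility as ℕ using ()
  import Data.Nat.Properties as ℕ
  open import Data.Nat.Primality using (euclidsLemma; prime⇒nonTrivial)
  open import Data.Integer using (+_; 0ℤ; 1ℤ; ∣_∣; _+_; _*_; _-_)
  import Data.Integer.Properties as ℤ
  open import Data.Integer.Divisibility.Signed using (∣⇒∣ᵤ; ∣ᵤ⇒∣)
  open import Relation.Binary.PropositionalEquality using (_≡_; _≢_; refl; subst; cong)
  import Relation.Binary.Reasoning.Setoid as ≈-Reasoning
  open IntegersModulo
  open Residues k
  open IntegerPolynomials
  open import Data.Fin using (Fin; zero; suc)
  import Data.Fin.Properties as Fin
  open import Data.Product using (∃; _,_)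
  import Data.Sum as Sum
  open import Data.Sum using (fromInj₂)
  open import Function using (_∘_)
  open import Function.Definitions using (Injective)
  open import Defs using (modn)

  p = suc k

  module ℤₚ = CommutativeRing ℤ/ p ℤ
  open import Algebra.Properties.Semiring.Exp ℤₚ.semiring using (_^_; ^-congˡ; ^-congʳ)
  open DomainProperties ℤ/ p ℤ using (NoZeroDivisors; *-cancelˡ)
  open import Algebra.Properties.Ring ℤₚ.ring using (x∙y⁻¹≈ε⇒x≈y)
  open FreshmansDream ℤₚ.commutativeSemiring using (freshman's-dream)

  noZeroDivisors : NoZeroDivisors
  noZeroDivisors a b ab≡0 =
    Sum.map (∣⇒≡0mod ∘ ∣ᵤ⇒∣) (∣⇒≡0mod ∘ ∣ᵤ⇒∣) (euclidsLemma ∣ a ∣ ∣ b ∣ p-prime p∣∣a∣∣b∣)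
    where
    p∣∣a∣∣b∣ : p ℕ.∣ ∣ a ∣ ℕ.* ∣ b ∣
    p∣∣a∣∣b∣ = subst (p ℕ.∣_) (ℤ.abs-* a b) (∣⇒∣ᵤ (≡0mod⇒∣ ab≡0))

  1^n≡1 : ∀ n → 1ℤ ^ n ≡ 1ℤ mod p
  1^n≡1 zero    = ℤₚ.refl
  1^n≡1 (suc n) = ℤₚ.trans (ℤₚ.*-identityˡ (1ℤ ^ n)) (1^n≡1 n)

  fermat : ∀ a → a ^ p ≡ a mod p
  fermat a = ℤₚ.trans (^-congˡ p (ℤₚ.sym (modn≡mod a))) (ℤₚ.trans (fermat-ℕ (modn p a)) (modn≡mod a))
    where
    fermat-ℕ : ∀ n → (+ n) ^ p ≡ + n mod p
    fermat-ℕ zero    = ℤₚ.refl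
    fermat-ℕ (suc n) = begin
      (1ℤ + + n) ^ p        ≈⟨ freshman's-dream p-prime (characteristic p) 1ℤ (+ n) ⟩
      1ℤ ^ p + (+ n) ^ p    ≈⟨ ℤₚ.+-cong (1^n≡1 p) (fermat-ℕ n) ⟩
      1ℤ + + n              ∎
      where open ≈-Reasoning ℤₚ.setoid

  fermat-unit : ∀ {a} → ¬ a ≡ 0ℤ mod p → a ^ k ≡ 1ℤ mod p
  fermat-unit {a} a≢0 = *-cancelˡ noZeroDivisors a≢0 (ℤₚ.trans (fermat a) (ℤₚ.sym (ℤₚ.*-identityʳ a)))

  inverse : ∀ {a} → ¬ a ≡ 0ℤ mod p → ∃ λ w → a * w ≡ 1ℤ mod p
  inverse {a} a≢0 = a ^ ℕ.pred k , ℤₚ.trans (^-congʳ a (ℕ.suc-pred k {{ℕ.≢-nonZero k≢0}})) (fermat-unit a≢0)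
    where
    k≢0 : k ≢ 0
    k≢0 k≡0 = ℕ.nonTrivial⇒≢1 {{prime⇒nonTrivial p-prime}} (cong suc k≡0)

  lagrange : ∀ {n f} → DegreeBelow n f → (r : Fin n → ℤ) → Injective _≡_ ℤₚ._≈_ r →
             (∀ i → f (r i) ≡ 0ℤ mod p) → ∀ t → f t ≡ 0ℤ mod p
  lagrange (vanishing f≡0) r r-injective roots t = ≡⇒≡mod (f≡0 t)
  lagrange {f = f} f-poly@(horner _ _ _ _) r r-injective roots t
    with factor-theorem f-poly (r zero)
  ... | q , q-poly , f≡fr₀+[t-r₀]q = begin
    f t                         ≡⟨ f≡fr₀+[t-r₀]q t ⟩
    f r₀ + (t - r₀) * q t       ≈⟨ ℤₚ.+-cong (roots zero) (ℤₚ.*-congˡ {t - r₀} (q≡0 t)) ⟩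
    0ℤ + (t - r₀) * 0ℤ          ≡⟨ ℤ.+-identityˡ ((t - r₀) * 0ℤ) ⟩
    (t - r₀) * 0ℤ               ≡⟨ ℤ.*-zeroʳ (t - r₀) ⟩
    0ℤ                          ∎
    where
    open ≈-Reasoning ℤₚ.setoid
    r₀ = r zero
    [rᵢ-r₀]q[rᵢ]≡0 : ∀ i → (r (suc i) - r₀) * q (r (suc i)) ≡ 0ℤ mod p
    [rᵢ-r₀]q[rᵢ]≡0 i = begin
      (rᵢ - r₀) * q rᵢ          ≈⟨ ℤₚ.+-identityˡ _ ⟨
      0ℤ + (rᵢ - r₀) * q rᵢ     ≈⟨ ℤₚ.+-congʳ (roots zero) ⟨
      f r₀ + (rᵢ - r₀) * q rᵢ   ≡⟨ f≡fr₀+[t-r₀]q rᵢ ⟨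
      f rᵢ                      ≈⟨ roots (suc i) ⟩
      0ℤ                        ∎
      where rᵢ = r (suc i)
    q-roots : ∀ i → q (r (suc i)) ≡ 0ℤ mod p
    q-roots i = fromInj₂ (λ rᵢ-r₀≡0 → contradiction (r-injective (x∙y⁻¹≈ε⇒x≈y _ _ rᵢ-r₀≡0)) λ ())
                         (noZeroDivisors _ _ ([rᵢ-r₀]q[rᵢ]≡0 i))
    q≡0 : ∀ t → q t ≡ 0ℤ mod p
    q≡0 = lagrange q-poly (λ i → r (suc i)) (λ rᵢ≡rⱼ → Fin.suc-injective (r-injective rᵢ≡rⱼ)) q-roots

module OddPrimeModulus (m : ℕ) (p-prime : Prime (suc (m ℕ.+ m))) where

  open import Data.Nat as ℕ using (zero; s≤s; _<_)
  import Data.Nat.Properties as ℕ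
  open import Data.Nat.Primality using (prime⇒nonTrivial)
  open import Data.Integer using (+_; 0ℤ; 1ℤ; _+_; _*_; -_; _-_)
  import Data.Integer.Properties as ℤ
  open import Data.Fin using (Fin; zero; suc; toℕ)
  import Data.Fin.Properties as Fin
  open import Data.Product using (_,_)
  open import Data.Sum using (_⊎_; fromInj₂; [_,_]′)
  open import Relation.Binary.PropositionalEquality using (_≡_; _≢_; refl; sym; cong)
  open import Function.Definitions using (Injective)
  import Relation.Binary.Reasoning.Setoid as ≈-Reasoning
  open IntegersModulo
  open IntegerPolynomials
  open PrimeModulus (m ℕ.+ m) p-prime
  open Residues (m ℕ.+ m)
  open DomainProperties ℤ/ p ℤ using (x*x≈y*y⇒x≈y⊎x≈-y; x*x≈1⇒x≈1⊎x≈-1; *-cancelˡ)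
  open import Algebra.Properties.Ring ℤₚ.ring using (x∙y⁻¹≈ε⇒x≈y; x≈y⇒x∙y⁻¹≈ε)
  open import Data.Integer.Tactic.RingSolver using (solve-∀)
  open import Algebra.Properties.Semiring.Exp ℤₚ.semiring using (_^_; ^-homo-*)
  open import Algebra.Properties.CommutativeSemiring.Exp ℤₚ.commutativeSemiring using (^-distrib-*)

  m≢0 : m ≢ 0
  m≢0 m≡0 = ℕ.nonTrivial⇒≢1 {{prime⇒nonTrivial p-prime}} (cong (λ m → suc (m ℕ.+ m)) m≡0)

  1≤m : 1 ℕ.≤ m
  1≤m = ℕ.n≢0⇒n>0 m≢0

  ≤m⇒<p : ∀ {n} → n ℕ.≤ m → n < p
  ≤m⇒<p n≤m = s≤s (ℕ.≤-trans n≤m (ℕ.m≤m+n m m))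

  +n≢0 : ∀ {n} → 0 < n → n < p → ¬ + n ≡ 0ℤ mod p
  +n≢0 {suc n} _ n<p n≡0 = ℕ.1+n≢0 (residue-injective n<p (s≤s ℕ.z≤n) n≡0)

  double-injective : ∀ {x y} → x + x ≡ y + y mod p → x ≡ y mod p
  double-injective {x} {y} 2x≡2y = x∙y⁻¹≈ε⇒x≈y x y (*-cancelˡ noZeroDivisors 2≢0 (begin
    + 2 * (x - y)        ≡⟨ lemma x y ⟩
    (x + x) - (y + y)    ≈⟨ x≈y⇒x∙y⁻¹≈ε 2x≡2y ⟩
    0ℤ                   ≡⟨ ℤ.*-zeroʳ (+ 2) ⟨
    + 2 * 0ℤ             ∎))
    where
    open ≈-Reasoning ℤₚ.setoid
    2≢0 : ¬ + 2 ≡ 0ℤ mod p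
    2≢0 = +n≢0 (s≤s ℕ.z≤n) (s≤s (ℕ.+-mono-≤ 1≤m 1≤m))
    lemma : ∀ x y → + 2 * (x - y) ≡ (x + x) - (y + y)
    lemma = solve-∀

  x^m*x^m≡1 : ∀ {x} → ¬ x ≡ 0ℤ mod p → x ^ m * x ^ m ≡ 1ℤ mod p
  x^m*x^m≡1 {x} x≢0 = ℤₚ.trans (ℤₚ.sym (^-homo-* x m m)) (fermat-unit x≢0)

  xⁿ : ∀ n → DegreeBelow (suc n) (_^ n)
  xⁿ zero    = horner 1ℤ (λ _ → 0ℤ) (vanishing λ _ → refl) λ t → cong (_+_ 1ℤ) (sym (ℤ.*-zeroʳ t))
  xⁿ (suc n) = horner 0ℤ (_^ n) (xⁿ n) λ t → sym (ℤ.+-identityˡ (t * t ^ n))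

  0^n≡0 : ∀ {n} → n ≢ 0 → 0ℤ ^ n ≡ 0ℤ
  0^n≡0 {zero}  n≢0 = contradiction refl n≢0
  0^n≡0 {suc n} _   = refl

  positive : Fin m → ℕ
  positive i = suc (toℕ i)

  positive≤m : ∀ i → positive i ℕ.≤ m
  positive≤m = Fin.toℕ<n

  square : Fin m → ℤ
  square i = + positive i * + positive i

  square^m≡1 : ∀ i → square i ^ m ≡ 1ℤ mod p
  square^m≡1 i =
    ℤₚ.trans (^-distrib-* (+ positive i) (+ positive i) m) (x^m*x^m≡1 (+n≢0 (s≤s ℕ.z≤n) (≤m⇒<p (positive≤m i))))

  square-injective : ∀ i j → square i ≡ square j mod p → i ≡ j
  square-injective i j i²≡j² =
    [ +i≡+j⇒i≡j , +i≡-j⇒i≡j ]′ (x*x≈y*y⇒x≈y⊎x≈-y noZeroDivisors {+ positive i} {+ positive j} i²≡j²)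
    where
    +i≡+j⇒i≡j : + positive i ≡ + positive j mod p → i ≡ j
    +i≡+j⇒i≡j i≡j = Fin.toℕ-injective (ℕ.suc-injective
      (residue-injective (≤m⇒<p (positive≤m i)) (≤m⇒<p (positive≤m j)) i≡j))
    +i≡-j⇒i≡j : + positive i ≡ - + positive j mod p → i ≡ j
    +i≡-j⇒i≡j i≡-j = contradiction i+j≡0 (+n≢0 (s≤s ℕ.z≤n) (s≤s (ℕ.+-mono-≤ (positive≤m i) (positive≤m j))))
      where
      i+j≡0 : + positive i + + positive j ≡ 0ℤ mod p
      i+j≡0 = ℤₚ.trans (ℤₚ.+-congʳ {+ positive j} i≡-j) (ℤₚ.-‿inverseˡ (+ positive j))

  nonsquare⇒^m≢1 : ∀ {D} → ¬ SquareMod p D → ¬ D ^ m ≡ 1ℤ mod p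
  nonsquare⇒^m≢1 {D} D-nonsquare D^m≡1 = +n≢0 {1} (s≤s ℕ.z≤n) (≤m⇒<p 1≤m) 1≡0
    where
    open ≈-Reasoning ℤₚ.setoid
    root : Fin (suc m) → ℤ
    root zero    = D
    root (suc i) = square i
    root-injective : Injective _≡_ ℤₚ._≈_ root
    root-injective {zero}  {zero}  _      = refl
    root-injective {zero}  {suc j} D≡j²   = contradiction (+ positive j , D≡j²) D-nonsquare
    root-injective {suc i} {zero}  i²≡D   = contradiction (+ positive i , ℤₚ.sym i²≡D) D-nonsquare
    root-injective {suc i} {suc j} i²≡j²  = cong suc (square-injective i j i²≡j²)
    roots : ∀ i → root i ^ m - 1ℤ ≡ 0ℤ mod p
    roots zero    = ℤₚ.+-congʳ D^m≡1
    roots (suc i) = ℤₚ.+-congʳ (square^m≡1 i)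
    0^m-1≡0 : 0ℤ ^ m - 1ℤ ≡ 0ℤ mod p
    0^m-1≡0 = lagrange (+-const (xⁿ m) (- 1ℤ)) root root-injective roots 0ℤ
    1≡0 : 1ℤ ≡ 0ℤ mod p
    1≡0 = begin
      1ℤ                    ≡⟨ cong (λ x → - (x - 1ℤ)) (0^n≡0 m≢0) ⟨
      - (0ℤ ^ m - 1ℤ)       ≈⟨ ℤₚ.-‿cong 0^m-1≡0 ⟩
      0ℤ                    ∎

  nonsquare⇒^m≡-1 : ∀ {D} → ¬ SquareMod p D → D ^ m ≡ - 1ℤ mod p
  nonsquare⇒^m≡-1 {D} D-nonsquare = fromInj₂ (λ D^m≡1 → contradiction D^m≡1 (nonsquare⇒^m≢1 D-nonsquare)) D^m≡±1
    where
    D≢0 : ¬ D ≡ 0ℤ mod p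
    D≢0 D≡0 = D-nonsquare (0ℤ , D≡0)
    D^m≡±1 : D ^ m ≡ 1ℤ mod p ⊎ D ^ m ≡ - 1ℤ mod p
    D^m≡±1 = x*x≈1⇒x≈1⊎x≈-1 noZeroDivisors (x^m*x^m≡1 D≢0)

module QuadraticRing (n : ℕ) (b c : ℤ) where

  open import Data.Nat using (zero)
  open import Data.Integer using (+_; 0ℤ; 1ℤ; _+_; _*_; _-_)
  open import Data.Integer.Tactic.RingSolver using (solve-∀)
  open import Data.Product using (_×_; _,_)
  open import Algebra.Bundles using (AbelianGroup)
  open import Algebra.Consequences.Setoid using (comm∧idˡ⇒id; comm∧distrʳ⇒distr)
  import Algebra.Construct.DirectProduct as DirectProduct
  open import Level using (0ℓ)
  open import Relation.Binary.PropositionalEquality using (_≡_; refl; cong)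
  open IntegersModulo

  module ℤₙ = CommutativeRing ℤ/ n ℤ

  +-abelianGroup : AbelianGroup 0ℓ 0ℓ
  +-abelianGroup = DirectProduct.abelianGroup ℤₙ.+-abelianGroup ℤₙ.+-abelianGroup

  open AbelianGroup +-abelianGroup using (_≈_; setoid; ∙-cong; isAbelianGroup) renaming (_∙_ to _⊕_; _⁻¹ to ⊝_)

  ≡×≡⇒≈ : ∀ {u v u′ v′} → u ≡ u′ → v ≡ v′ → (u , v) ≈ (u′ , v′)
  ≡×≡⇒≈ u≡u′ v≡v′ = ℤₙ.reflexive u≡u′ , ℤₙ.reflexive v≡v′

  infixl 7 _·_
  _·_ : ℤ × ℤ → ℤ × ℤ → ℤ × ℤ
  (u₁ , v₁) · (u₂ , v₂) = b * (u₁ * u₂) + (u₁ * v₂ + u₂ * v₁) , c * (u₁ * u₂) + v₁ * v₂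

  ·-cong : ∀ {x x′ y y′} → x ≈ x′ → y ≈ y′ → x · y ≈ x′ · y′
  ·-cong (u₁≡ , v₁≡) (u₂≡ , v₂≡) =
    ℤₙ.+-cong (ℤₙ.*-congˡ {b} (ℤₙ.*-cong u₁≡ u₂≡)) (ℤₙ.+-cong (ℤₙ.*-cong u₁≡ v₂≡) (ℤₙ.*-cong u₂≡ v₁≡)) ,
    ℤₙ.+-cong (ℤₙ.*-congˡ {c} (ℤₙ.*-cong u₁≡ u₂≡)) (ℤₙ.*-cong v₁≡ v₂≡)

  ·-assoc : ∀ x y z → (x · y) · z ≈ x · (y · z)
  ·-assoc (u₁ , v₁) (u₂ , v₂) (u₃ , v₃) = ≡×≡⇒≈ (lemma₁ b c u₁ v₁ u₂ v₂ u₃ v₃) (lemma₂ b c u₁ v₁ u₂ v₂ u₃ v₃)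
    where
    lemma₁ : ∀ b c u₁ v₁ u₂ v₂ u₃ v₃ →
      b * ((b * (u₁ * u₂) + (u₁ * v₂ + u₂ * v₁)) * u₃)
        + ((b * (u₁ * u₂) + (u₁ * v₂ + u₂ * v₁)) * v₃ + u₃ * (c * (u₁ * u₂) + v₁ * v₂))
      ≡ b * (u₁ * (b * (u₂ * u₃) + (u₂ * v₃ + u₃ * v₂)))
        + (u₁ * (c * (u₂ * u₃) + v₂ * v₃) + (b * (u₂ * u₃) + (u₂ * v₃ + u₃ * v₂)) * v₁)
    lemma₁ = solve-∀
    lemma₂ : ∀ b c u₁ v₁ u₂ v₂ u₃ v₃ →
      c * ((b * (u₁ * u₂) + (u₁ * v₂ + u₂ * v₁)) * u₃) + (c * (u₁ * u₂) + v₁ * v₂) * v₃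
      ≡ c * (u₁ * (b * (u₂ * u₃) + (u₂ * v₃ + u₃ * v₂))) + v₁ * (c * (u₂ * u₃) + v₂ * v₃)
    lemma₂ = solve-∀

  ·-comm : ∀ x y → x · y ≈ y · x
  ·-comm (u₁ , v₁) (u₂ , v₂) = ≡×≡⇒≈ (lemma₁ b u₁ v₁ u₂ v₂) (lemma₂ c u₁ v₁ u₂ v₂)
    where
    lemma₁ : ∀ b u₁ v₁ u₂ v₂ → b * (u₁ * u₂) + (u₁ * v₂ + u₂ * v₁) ≡ b * (u₂ * u₁) + (u₂ * v₁ + u₁ * v₂)
    lemma₁ = solve-∀
    lemma₂ : ∀ c u₁ v₁ u₂ v₂ → c * (u₁ * u₂) + v₁ * v₂ ≡ c * (u₂ * u₁) + v₂ * v₁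
    lemma₂ = solve-∀

  ·-identityˡ : ∀ x → (0ℤ , 1ℤ) · x ≈ x
  ·-identityˡ (u , v) = ≡×≡⇒≈ (lemma₁ b u v) (lemma₂ c u v)
    where
    lemma₁ : ∀ b u v → b * (0ℤ * u) + (0ℤ * v + u * 1ℤ) ≡ u
    lemma₁ = solve-∀
    lemma₂ : ∀ c u v → c * (0ℤ * u) + 1ℤ * v ≡ v
    lemma₂ = solve-∀

  ·-distribʳ : ∀ x y z → (y ⊕ z) · x ≈ (y · x) ⊕ (z · x)
  ·-distribʳ (u₁ , v₁) (u₂ , v₂) (u₃ , v₃) = ≡×≡⇒≈ (lemma₁ b u₁ v₁ u₂ v₂ u₃ v₃) (lemma₂ c u₁ v₁ u₂ v₂ u₃ v₃)
    where
    lemma₁ : ∀ b u₁ v₁ u₂ v₂ u₃ v₃ → b * ((u₂ + u₃) * u₁) + ((u₂ + u₃) * v₁ + u₁ * (v₂ + v₃))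
           ≡ (b * (u₂ * u₁) + (u₂ * v₁ + u₁ * v₂)) + (b * (u₃ * u₁) + (u₃ * v₁ + u₁ * v₃))
    lemma₁ = solve-∀
    lemma₂ : ∀ c u₁ v₁ u₂ v₂ u₃ v₃ → c * ((u₂ + u₃) * u₁) + (v₂ + v₃) * v₁
           ≡ (c * (u₂ * u₁) + v₂ * v₁) + (c * (u₃ * u₁) + v₃ * v₁)
    lemma₂ = solve-∀

  quadraticRing : CommutativeRing 0ℓ 0ℓ
  quadraticRing = record
    { Carrier = ℤ × ℤ
    ; _≈_ = _≈_
    ; _+_ = _⊕_
    ; _*_ = _·_
    ; -_ = ⊝_
    ; 0# = 0ℤ , 0ℤ
    ; 1# = 0ℤ , 1ℤ
    ; isCommutativeRing = record
      { isRing = record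
        { +-isAbelianGroup = isAbelianGroup
        ; *-cong = ·-cong
        ; *-assoc = ·-assoc
        ; *-identity = comm∧idˡ⇒id setoid ·-comm ·-identityˡ
        ; distrib = comm∧distrʳ⇒distr setoid ∙-cong ·-comm ·-distribʳ
        }
      ; *-comm = ·-comm
      }
    }

  module Q = CommutativeRing quadraticRing
  open import Algebra.Properties.Semiring.Exp Q.semiring using (_^_)
  open import Algebra.Properties.Semiring.Mult Q.semiring using () renaming (_×_ to _×ᵣ_)
  open import Algebra.Properties.Semiring.Exp ℤₙ.semiring public using () renaming (_^_ to _^ₙ_)

  X : ℤ × ℤ
  X = 1ℤ , 0ℤ

  ι : ℤ → ℤ × ℤ
  ι a = 0ℤ , a

  ι-cong : ∀ {a a′} → a ≡ a′ mod n → ι a ≈ ι a′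
  ι-cong a≡a′ = ℤₙ.refl , a≡a′

  ι-* : ∀ a a′ → ι a · ι a′ ≈ ι (a * a′)
  ι-* a a′ = ≡×≡⇒≈ (lemma₁ b a a′) (lemma₂ c a a′)
    where
    lemma₁ : ∀ b a a′ → b * (0ℤ * 0ℤ) + (0ℤ * a′ + 0ℤ * a) ≡ 0ℤ
    lemma₁ = solve-∀
    lemma₂ : ∀ c a a′ → c * (0ℤ * 0ℤ) + a * a′ ≡ a * a′
    lemma₂ = solve-∀

  ι-^ : ∀ a k → ι a ^ k ≈ ι (a ^ₙ k)
  ι-^ a zero    = ℤₙ.refl , ℤₙ.refl
  ι-^ a (suc k) = Q.trans (Q.*-congˡ {ι a} (ι-^ a k)) (ι-* a (a ^ₙ k))

  quadratic-characteristic : n ×ᵣ Q.1# ≈ Q.0#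
  quadratic-characteristic = Q.trans (Q.reflexive (k×1≡ι[k] n)) (ℤₙ.refl , n≡0 n)
    where
    k×1≡ι[k] : ∀ k → k ×ᵣ Q.1# ≡ ι (+ k)
    k×1≡ι[k] zero    = refl
    k×1≡ι[k] (suc k) = cong (Q.1# Q.+_) (k×1≡ι[k] k)

  norm : ℤ × ℤ → ℤ
  norm (u , v) = v * v + b * u * v - c * u * u

  norm-· : ∀ x y → norm (x · y) ≡ norm x * norm y
  norm-· (u₁ , v₁) (u₂ , v₂) = lemma b c u₁ v₁ u₂ v₂
    where
    lemma : ∀ b c u₁ v₁ u₂ v₂ →
      (c * (u₁ * u₂) + v₁ * v₂) * (c * (u₁ * u₂) + v₁ * v₂)
        + b * (b * (u₁ * u₂) + (u₁ * v₂ + u₂ * v₁)) * (c * (u₁ * u₂) + v₁ * v₂)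
        - c * (b * (u₁ * u₂) + (u₁ * v₂ + u₂ * v₁)) * (b * (u₁ * u₂) + (u₁ * v₂ + u₂ * v₁))
      ≡ (v₁ * v₁ + b * u₁ * v₁ - c * u₁ * u₁) * (v₂ * v₂ + b * u₂ * v₂ - c * u₂ * u₂)
    lemma = solve-∀

  norm-cong : ∀ {x y} → x ≈ y → norm x ≡ norm y mod n
  norm-cong (u≡ , v≡) =
    ℤₙ.+-cong (ℤₙ.+-cong (ℤₙ.*-cong v≡ v≡) (ℤₙ.*-cong (ℤₙ.*-congˡ {b} u≡) v≡))
              (ℤₙ.-‿cong (ℤₙ.*-cong (ℤₙ.*-congˡ {c} u≡) u≡))

module Reduction (k : ℕ) (b c : ℤ) where

  open import Data.Nat using (zero)
  open import Data.Integer using (+_; _*_)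
  import Data.Integer.Properties as ℤ
  open import Data.Product using (_×_; _,_)
  open import Relation.Binary.PropositionalEquality using (_≡_; refl; trans; cong; cong₂)
  open import Defs using (R; modn; mulR; xR; xpow)
  open IntegersModulo
  open Residues k
  open QuadraticRing (suc k) b c
  open import Algebra.Properties.Semiring.Exp Q.semiring using (_^_)

  private
    n = suc k

  reduce : ℤ × ℤ → R
  reduce (u , v) = modn n u , modn n v

  reduce-cong : ∀ {x y} → x Q.≈ y → reduce x ≡ reduce y
  reduce-cong (u≡u′ , v≡v′) = cong₂ _,_ (≡mod⇒modn≡ u≡u′) (≡mod⇒modn≡ v≡v′)

  reduce-· : ∀ x y → mulR n b c (reduce x) (reduce y) ≡ reduce (x · y)
  reduce-· (u₁ , v₁) (u₂ , v₂) = cong₂ _,_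
    (≡mod⇒modn≡ (ℤₙ.+-cong (ℤₙ.*-congˡ {b} (residue-* u₁ u₂)) (ℤₙ.+-cong (residue-* u₁ v₂) (residue-* u₂ v₁))))
    (≡mod⇒modn≡ (ℤₙ.+-cong (ℤₙ.*-congˡ {c} (residue-* u₁ u₂)) (residue-* v₁ v₂)))
    where
    residue-* : ∀ x y → + (modn n x ℕ.* modn n y) ≡ x * y mod n
    residue-* x y = ℤₙ.trans (ℤₙ.reflexive (ℤ.pos-* (modn n x) (modn n y))) (ℤₙ.*-cong (modn≡mod x) (modn≡mod y))

  xpow≡reduce[X^] : ∀ e → xpow n b c e ≡ reduce (X ^ e)
  xpow≡reduce[X^] zero    = refl
  xpow≡reduce[X^] (suc e) = trans (cong (mulR n b c (xR n)) (xpow≡reduce[X^] e)) (reduce-· X (X ^ e))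

module QuadraticField (k : ℕ) (p-prime : Prime (suc k)) (b c : ℤ)
                     (D-nonsquare : ¬ IntegersModulo.SquareMod (suc k) (b ℤ.* b ℤ.+ ℤ.+ 4 ℤ.* c)) where

  open import Data.Integer using (+_; 0ℤ; 1ℤ; _+_; _*_; _-_)
  open import Data.Integer.Tactic.RingSolver using (solve-∀)
  open import Data.Product using (_,_; proj₁; proj₂)
  open import Data.Sum using ([_,_]′)
  import Data.Sum as Sum
  open import Function using (id)
  open import Relation.Nullary.Decidable using (toSum)
  open import Relation.Binary.PropositionalEquality using (_≡_)
  import Relation.Binary.Reasoning.Setoid as ≈-Reasoning
  open IntegersModulo
  open Residues k using (≡mod-dec)
  open PrimeModulus k p-prime using (p; module ℤₚ; noZeroDivisors; inverse)
  open import Algebra.Properties.Ring ℤₚ.ring using (x∙y⁻¹≈ε⇒x≈y; x≈y⇒x∙y⁻¹≈ε)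
  open QuadraticRing p b c
  open DomainProperties quadraticRing using (NoZeroDivisors)

  D : ℤ
  D = b * b + + 4 * c

  norm≡0⇒≈0 : ∀ x → norm x ≡ 0ℤ mod p → x Q.≈ Q.0#
  norm≡0⇒≈0 (u , v) N≡0 = [ u≡0⇒≈0 , u≢0⇒≈0 ]′ (toSum (≡mod-dec u 0ℤ))
    where
    open ≈-Reasoning ℤₚ.setoid
    u≡0⇒≈0 : u ≡ 0ℤ mod p → (u , v) Q.≈ Q.0#
    u≡0⇒≈0 u≡0 = u≡0 , [ id , id ]′ (noZeroDivisors v v v*v≡0)
      where
      lemma : ∀ b c v → v * v ≡ v * v + b * 0ℤ * v - c * 0ℤ * 0ℤ
      lemma = solve-∀
      v*v≡0 : v * v ≡ 0ℤ mod p
      v*v≡0 = begin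
        v * v             ≡⟨ lemma b c v ⟩
        norm (0ℤ , v)     ≈⟨ norm-cong {0ℤ , v} {u , v} (ℤₚ.sym u≡0 , ℤₚ.refl) ⟩
        norm (u , v)      ≈⟨ N≡0 ⟩
        0ℤ                ∎
    -- Completing the square: with u w = 1, a vanishing norm makes ((2v + b u) w)² = D.
    u≢0⇒≈0 : ¬ u ≡ 0ℤ mod p → (u , v) Q.≈ Q.0#
    u≢0⇒≈0 u≢0 = contradiction (t , ℤₚ.sym t*t≡D) D-nonsquare
      where
      w = proj₁ (inverse u≢0)
      t = (+ 2 * v + b * u) * w
      4w² = w * w * + 4
      D[uw+1] = D * (u * w + 1ℤ)
      lemma : ∀ b c u v w → ((+ 2 * v + b * u) * w) * ((+ 2 * v + b * u) * w) - (b * b + + 4 * c)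
              ≡ (w * w * + 4) * (v * v + b * u * v - c * u * u) + ((b * b + + 4 * c) * (u * w + 1ℤ)) * (u * w - 1ℤ)
      lemma = solve-∀
      lemma₀ : ∀ x y → x * 0ℤ + y * 0ℤ ≡ 0ℤ
      lemma₀ = solve-∀
      uw-1≡0 : u * w - 1ℤ ≡ 0ℤ mod p
      uw-1≡0 = x≈y⇒x∙y⁻¹≈ε (proj₂ (inverse u≢0))
      t*t≡D : t * t ≡ D mod p
      t*t≡D = x∙y⁻¹≈ε⇒x≈y (t * t) D (begin
        t * t - D                                    ≡⟨ lemma b c u v w ⟩
        4w² * norm (u , v) + D[uw+1] * (u * w - 1ℤ)  ≈⟨ ℤₚ.+-cong (ℤₚ.*-congˡ {4w²} N≡0)
                                                                  (ℤₚ.*-congˡ {D[uw+1]} uw-1≡0) ⟩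
        4w² * 0ℤ + D[uw+1] * 0ℤ                      ≡⟨ lemma₀ 4w² D[uw+1] ⟩
        0ℤ                                           ∎)

  quadratic-noZeroDivisors : NoZeroDivisors
  quadratic-noZeroDivisors x y xy≈0 = Sum.map (norm≡0⇒≈0 x) (norm≡0⇒≈0 y) (noZeroDivisors (norm x) (norm y) NxNy≡0)
    where
    open ≈-Reasoning ℤₚ.setoid
    lemma : ∀ b c → 0ℤ * 0ℤ + b * 0ℤ * 0ℤ - c * 0ℤ * 0ℤ ≡ 0ℤ
    lemma = solve-∀
    NxNy≡0 : norm x * norm y ≡ 0ℤ mod p
    NxNy≡0 = begin
      norm x * norm y   ≡⟨ norm-· x y ⟨
      norm (x · y)      ≈⟨ norm-cong xy≈0 ⟩
      norm Q.0#         ≡⟨ lemma b c ⟩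
      0ℤ                ∎

module QuadraticFrobenius (m : ℕ) (p-prime : Prime (suc (m ℕ.+ m))) (b c : ℤ)
                          (D-nonsquare : ¬ IntegersModulo.SquareMod (suc (m ℕ.+ m)) (b ℤ.* b ℤ.+ ℤ.+ 4 ℤ.* c)) where

  open import Data.Nat as ℕ using (zero)
  import Data.Nat.Properties as ℕ
  open import Data.Nat.DivMod using (m*n%n≡0; m*n/n≡m)
  open import Data.Nat.Tactic.RingSolver using () renaming (solve-∀ to ℕ-solve-∀)
  open import Data.Integer using (+_; 0ℤ; 1ℤ; _+_; _*_; -_)
  import Data.Integer.Properties as ℤ
  open import Data.Integer.Tactic.RingSolver using (solve-∀)
  open import Data.Product using (_×_; _,_; proj₁)
  open import Data.Sum using ([_,_]′)
  open import Relation.Binary.PropositionalEquality using (_≡_; sym; trans; cong; subst)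
  open import Defs using (OddNat; xpow; Step3Composite; Step4Composite; Step5Composite)
  open IntegersModulo
  open PrimeModulus (m ℕ.+ m) p-prime using (p; module ℤₚ; fermat)
  open Residues (m ℕ.+ m) using (≡mod⇒modn≡)
  open OddPrimeModulus m p-prime using (double-injective; x^m*x^m≡1; nonsquare⇒^m≡-1)
  open QuadraticRing p b c
  open QuadraticField (m ℕ.+ m) p-prime b c D-nonsquare using (D; quadratic-noZeroDivisors)
  open Reduction (m ℕ.+ m) b c using (reduce-cong; xpow≡reduce[X^])
  open DomainProperties quadraticRing using (x*x≈y*y⇒x≈y⊎x≈-y; x^2^r≈1⇒x≈1)
  open import Algebra.Properties.Semiring.Exp ℤₚ.semiring using () renaming (^-congˡ to ℤₚ^-congˡ)
  open import Algebra.Properties.CommutativeSemiring.Exp ℤₚ.commutativeSemiring using () renaming (^-distrib-* to ℤₚ^-distrib-*)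
  open import Algebra.Properties.Semiring.Exp Q.semiring using (_^_; ^-congˡ; ^-homo-*; ^-assocʳ)
  open import Algebra.Properties.CommutativeSemiring.Exp Q.commutativeSemiring using (^-distrib-*)
  open import Algebra.Properties.Ring Q.ring using (-1*x≈-x)
  open FreshmansDream Q.commutativeSemiring using (freshman's-dream)
  open import Relation.Binary.Reasoning.Setoid Q.setoid

  frobenius : ∀ x y → (x Q.+ y) ^ p Q.≈ x ^ p Q.+ y ^ p
  frobenius = freshman's-dream p-prime quadratic-characteristic

  ι-fermat : ∀ a → ι a ^ p Q.≈ ι a
  ι-fermat a = Q.trans (ι-^ a p) (ι-cong (fermat a))

  x^p≈x*[x*x]^m : ∀ x → x ^ p Q.≈ x Q.* (x Q.* x) ^ m
  x^p≈x*[x*x]^m x = Q.*-congˡ {x} (Q.trans (^-homo-* x m m) (Q.sym (^-distrib-* x x m)))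

  Y : ℤ × ℤ
  Y = (X Q.+ X) Q.+ ι (- b)

  Y*Y≈D : Y Q.* Y Q.≈ ι D
  Y*Y≈D = ≡×≡⇒≈ (lemma₁ b) (lemma₂ b c)
    where
    lemma₁ : ∀ b → b * (+ 2 * + 2) + (+ 2 * (0ℤ + - b) + + 2 * (0ℤ + - b)) ≡ 0ℤ
    lemma₁ = solve-∀
    lemma₂ : ∀ b c → c * (+ 2 * + 2) + (0ℤ + - b) * (0ℤ + - b) ≡ b * b + + 4 * c
    lemma₂ = solve-∀

  Y^p≈-Y : Y ^ p Q.≈ Q.- Y
  Y^p≈-Y = begin
    Y ^ p                   ≈⟨ x^p≈x*[x*x]^m Y ⟩
    Y Q.* (Y Q.* Y) ^ m     ≈⟨ Q.*-congˡ {Y} (^-congˡ m Y*Y≈D) ⟩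
    Y Q.* ι D ^ m           ≈⟨ Q.*-congˡ {Y} (ι-^ D m) ⟩
    Y Q.* ι (D ^ₙ m)        ≈⟨ Q.*-congˡ {Y} (ι-cong (nonsquare⇒^m≡-1 D-nonsquare)) ⟩
    Y Q.* Q.- Q.1#          ≈⟨ Q.*-comm Y (Q.- Q.1#) ⟩
    Q.- Q.1# Q.* Y          ≈⟨ -1*x≈-x Y ⟩
    Q.- Y                   ∎

  -- the conjugate root b − x of x² − b x − c
  X̄ : ℤ × ℤ
  X̄ = - 1ℤ , b

  X^p≈X̄ : X ^ p Q.≈ X̄
  X^p≈X̄ = halve (begin
    (X ^ p Q.+ X ^ p) Q.+ ι (- b)      ≈⟨ Q.+-cong (frobenius X X) (ι-fermat (- b)) ⟨
    (X Q.+ X) ^ p Q.+ ι (- b) ^ p      ≈⟨ frobenius (X Q.+ X) (ι (- b)) ⟨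
    Y ^ p                              ≈⟨ Y^p≈-Y ⟩
    Q.- Y                              ∎)
    where
    halve : ∀ {x} → (x Q.+ x) Q.+ ι (- b) Q.≈ Q.- Y → x Q.≈ X̄
    halve {g₁ , g₀} (h₁ , h₀) = double-injective h₁′ , double-injective h₀′
      where
      lemma₁ : ∀ g b → g ≡ (g + - b) + b
      lemma₁ = solve-∀
      lemma₂ : ∀ b → - (0ℤ + - b) + b ≡ b + b
      lemma₂ = solve-∀
      h₁′ : g₁ + g₁ ≡ - 1ℤ + - 1ℤ mod p
      h₁′ = ℤₚ.trans (ℤₚ.reflexive (sym (ℤ.+-identityʳ (g₁ + g₁)))) h₁
      h₀′ : g₀ + g₀ ≡ b + b mod p
      h₀′ = ℤₚ.trans (ℤₚ.reflexive (lemma₁ (g₀ + g₀) b))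
                     (ℤₚ.trans (ℤₚ.+-congʳ {b} h₀) (ℤₚ.reflexive (lemma₂ b)))

  X^[1+p]≈-c : X ^ suc p Q.≈ ι (- c)
  X^[1+p]≈-c = Q.trans (Q.*-congˡ {X} X^p≈X̄) (≡×≡⇒≈ (lemma₁ b) (lemma₂ b c))
    where
    lemma₁ : ∀ b → b * (1ℤ * - 1ℤ) + (1ℤ * b + - 1ℤ * 0ℤ) ≡ 0ℤ
    lemma₁ = solve-∀
    lemma₂ : ∀ b c → c * (1ℤ * - 1ℤ) + 0ℤ * b ≡ - c
    lemma₂ = solve-∀

  [p+1]/2≡1+m : (p ℕ.+ 1) ℕ./ 2 ≡ suc m
  [p+1]/2≡1+m = trans (cong (ℕ._/ 2) (lemma m)) (m*n/n≡m (suc m) 2)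
    where
    lemma : ∀ m → suc (m ℕ.+ m) ℕ.+ 1 ≡ suc m ℕ.* 2
    lemma = ℕ-solve-∀

  p²-1≡2[1+p]m : p ℕ.* p ℕ.∸ 1 ≡ 2 ℕ.* (suc p ℕ.* m)
  p²-1≡2[1+p]m = lemma m
    where
    lemma : ∀ m → (m ℕ.+ m) ℕ.+ (m ℕ.+ m) ℕ.* suc (m ℕ.+ m) ≡ 2 ℕ.* (suc (suc (m ℕ.+ m)) ℕ.* m)
    lemma = ℕ-solve-∀

  module _ {e : ℤ} (-c≡e*e : - c ≡ e * e mod p) (e≢0 : ¬ e ≡ 0ℤ mod p) where

    proj₁[X^[1+m]]≡0 : proj₁ (X ^ suc m) ≡ 0ℤ mod p
    proj₁[X^[1+m]]≡0 = [ proj₁ , proj₁ ]′ (x*x≈y*y⇒x≈y⊎x≈-y quadratic-noZeroDivisors {H} {ι e} H*H≈ιe*ιe)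
      where
      H = X ^ suc m
      H*H≈ιe*ιe : H Q.* H Q.≈ ι e Q.* ι e
      H*H≈ιe*ιe = begin
        H Q.* H                    ≈⟨ ^-homo-* X (suc m) (suc m) ⟨
        X ^ (suc m ℕ.+ suc m)      ≡⟨ cong (λ k → X ^ suc k) (ℕ.+-suc m m) ⟩
        X ^ suc p                  ≈⟨ X^[1+p]≈-c ⟩
        ι (- c)                    ≈⟨ ι-cong -c≡e*e ⟩
        ι (e * e)                  ≈⟨ ι-* e e ⟨
        ι e Q.* ι e                ∎

    X^[[1+p]m]≈1 : X ^ (suc p ℕ.* m) Q.≈ Q.1#
    X^[[1+p]m]≈1 = begin
      X ^ (suc p ℕ.* m)            ≈⟨ ^-assocʳ X (suc p) m ⟨
      (X ^ suc p) ^ m              ≈⟨ ^-congˡ m X^[1+p]≈-c ⟩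
      ι (- c) ^ m                  ≈⟨ ι-^ (- c) m ⟩
      ι ((- c) ^ₙ m)               ≈⟨ ι-cong [-c]^m≡1 ⟩
      ι 1ℤ                         ∎
      where
      [-c]^m≡1 : (- c) ^ₙ m ≡ 1ℤ mod p
      [-c]^m≡1 = ℤₚ.trans (ℤₚ^-congˡ m -c≡e*e) (ℤₚ.trans (ℤₚ^-distrib-* e e m) (x^m*x^m≡1 e≢0))

    X^s≈1 : ∀ r s → p ℕ.* p ℕ.∸ 1 ≡ 2 ℕ.^ r ℕ.* s → OddNat s →
            (∀ j → j ℕ.+ 2 ℕ.≤ r → ¬ X ^ (2 ℕ.^ j ℕ.* s) Q.≈ Q.- Q.1#) → X ^ s Q.≈ Q.1#
    X^s≈1 zero s p²-1≡s s-odd _ = contradiction (trans (sym s-odd) s-even) λ ()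
      where
      s≡[[1+p]m]*2 : s ≡ (suc p ℕ.* m) ℕ.* 2
      s≡[[1+p]m]*2 = trans (sym (ℕ.*-identityˡ s)) (trans (sym p²-1≡s) (trans p²-1≡2[1+p]m (ℕ.*-comm 2 (suc p ℕ.* m))))
      s-even : s ℕ.% 2 ≡ 0
      s-even = trans (cong (ℕ._% 2) s≡[[1+p]m]*2) (m*n%n≡0 (suc p ℕ.* m) 2)
    X^s≈1 (suc r) s p²-1≡2^[1+r]s _ no-1 = x^2^r≈1⇒x≈1 quadratic-noZeroDivisors r [X^s]^2^r≈1 [X^s]^2^j≉-1
      where
      2^r*s≡[1+p]m : 2 ℕ.^ r ℕ.* s ≡ suc p ℕ.* m
      2^r*s≡[1+p]m = ℕ.*-cancelˡ-≡ _ _ 2 (trans (sym (ℕ.*-assoc 2 (2 ℕ.^ r) s)) (trans (sym p²-1≡2^[1+r]s) p²-1≡2[1+p]m))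
      [X^s]^2^j≉-1 : ∀ j → j ℕ.< r → ¬ (X ^ s) ^ (2 ℕ.^ j) Q.≈ Q.- Q.1#
      [X^s]^2^j≉-1 j j<r [X^s]^2^j≈-1 = no-1 j (subst (ℕ._≤ suc r) (ℕ.+-comm 2 j) (ℕ.s≤s j<r)) (begin
        X ^ (2 ℕ.^ j ℕ.* s)          ≡⟨ cong (X ^_) (ℕ.*-comm (2 ℕ.^ j) s) ⟩
        X ^ (s ℕ.* 2 ℕ.^ j)          ≈⟨ ^-assocʳ X s (2 ℕ.^ j) ⟨
        (X ^ s) ^ (2 ℕ.^ j)          ≈⟨ [X^s]^2^j≈-1 ⟩
        Q.- Q.1#                     ∎)
      [X^s]^2^r≈1 : (X ^ s) ^ (2 ℕ.^ r) Q.≈ Q.1#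
      [X^s]^2^r≈1 = begin
        (X ^ s) ^ (2 ℕ.^ r)          ≈⟨ ^-assocʳ X s (2 ℕ.^ r) ⟩
        X ^ (s ℕ.* 2 ℕ.^ r)          ≡⟨ cong (X ^_) (trans (ℕ.*-comm s (2 ℕ.^ r)) 2^r*s≡[1+p]m) ⟩
        X ^ (suc p ℕ.* m)            ≈⟨ X^[[1+p]m]≈1 ⟩
        Q.1#                         ∎

    ¬step3 : ¬ Step3Composite p b c
    ¬step3 xpow[[p+1]/2]₁≢0 = xpow[[p+1]/2]₁≢0
      (trans (cong (λ k → proj₁ (xpow p b c k)) [p+1]/2≡1+m)
             (trans (cong proj₁ (xpow≡reduce[X^] (suc m))) (≡mod⇒modn≡ proj₁[X^[1+m]]≡0)))

    ¬step5 : ¬ Step5Composite p b c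
    ¬step5 (r , s , p²-1≡2^r*s , s-odd , xpow[s]≢1 , xpow[2^j*s]≢-1) =
      xpow[s]≢1 (trans (xpow≡reduce[X^] s) (reduce-cong (X^s≈1 r s p²-1≡2^r*s s-odd X^[2^j*s]≉-1)))
      where
      X^[2^j*s]≉-1 : ∀ j → j ℕ.+ 2 ℕ.≤ r → ¬ X ^ (2 ℕ.^ j ℕ.* s) Q.≈ Q.- Q.1#
      X^[2^j*s]≉-1 j j+2≤r X^[2^j*s]≈-1 =
        xpow[2^j*s]≢-1 j j+2≤r (trans (xpow≡reduce[X^] (2 ℕ.^ j ℕ.* s)) (reduce-cong X^[2^j*s]≈-1))

  ¬step4 : ¬ Step4Composite p b c
  ¬step4 xpow[p+1]≢-c = xpow[p+1]≢-c
    (trans (cong (xpow p b c) (ℕ.+-comm p 1)) (trans (xpow≡reduce[X^] (suc p)) (reduce-cong X^[1+p]≈-c)))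

module LegendreSymbol {k : ℕ} where

  import Data.Nat as ℕ
  open import Data.Integer using (+_; -[1+_]; 0ℤ; _*_)
  import Data.Integer.Properties as ℤ
  open import Data.Bool using (T; true; false)
  open import Data.List using (upTo)
  open import Data.List.Relation.Unary.Any using (satisfied)
  open import Data.List.Relation.Unary.Any.Properties using (any⁺; any⁻)
  open import Data.List.Membership.Propositional using (lose)
  open import Data.List.Membership.Propositional.Properties using (∈-upTo⁺)
  open import Data.Integer.DivMod using (n%ℕd<d)
  open import Data.Product using (∃; _×_; _,_)
  open import Relation.Nullary using (yes; no)
  open import Relation.Nullary.Decidable using (⌊_⌋; toWitness; fromWitness)
  open import Relation.Binary.PropositionalEquality using (_≡_; sym; subst)
  open import Defs using (modn; isSquareMod; legendre)
  open IntegersModulo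
  open Residues k

  private
    p = suc k

  T[isSquareMod]⇒square : ∀ {a} → T (isSquareMod a p) → SquareMod p a
  T[isSquareMod]⇒square {a} t = square (satisfied (any⁻ _ (upTo p) t))
    where
    square : ∃ (λ x → T ⌊ modn p (+ (x ℕ.* x)) ℕ.≟ modn p a ⌋) → SquareMod p a
    square (x , x²≡a) = + x , ≡mod-trans (≡mod-sym (modn≡⇒≡mod (toWitness x²≡a))) (≡⇒≡mod (ℤ.pos-* x x))

  square⇒T[isSquareMod] : ∀ {a} → SquareMod p a → T (isSquareMod a p)
  square⇒T[isSquareMod] {a} (t , a≡t*t) = any⁺ _ (lose (∈-upTo⁺ (n%ℕd<d t p)) (fromWitness x²≡a))
    where
    x = modn p t
    x²≡a : modn p (+ (x ℕ.* x)) ≡ modn p a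
    x²≡a = ≡mod⇒modn≡ (≡mod-trans (≡⇒≡mod (ℤ.pos-* x x))
                                  (≡mod-trans (*-cong-mod (modn≡mod t) (modn≡mod t)) (≡mod-sym a≡t*t)))

  legendre≡-1⇒nonsquare : ∀ {a} → legendre a p ≡ -[1+ 0 ] → ¬ SquareMod p a
  legendre≡-1⇒nonsquare {a} leg with modn p a ℕ.≟ 0
  legendre≡-1⇒nonsquare {a} () | yes _
  ... | no _ with isSquareMod a p in eq
  legendre≡-1⇒nonsquare {a} () | no _ | true
  ... | false = λ a-square → subst T eq (square⇒T[isSquareMod] a-square)

  legendre≡1⇒unit-square : ∀ {a} → legendre a p ≡ + 1 → ∃ λ e → a ≡ e * e mod p × ¬ e ≡ 0ℤ mod p
  legendre≡1⇒unit-square {a} leg with modn p a ℕ.≟ 0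
  legendre≡1⇒unit-square {a} () | yes _
  ... | no a≢0 with isSquareMod a p in eq
  ... | true = unit-root (T[isSquareMod]⇒square (subst T (sym eq) _))
    where
    unit-root : SquareMod p a → ∃ λ e → a ≡ e * e mod p × ¬ e ≡ 0ℤ mod p
    unit-root (e , a≡e*e) = e , a≡e*e , λ e≡0 → a≢0 (≡mod⇒modn≡ (≡mod-trans a≡e*e (*-cong-mod e≡0 e≡0)))
  legendre≡1⇒unit-square {a} () | no _ | false

module PrimeArithmetic where

  open import Data.Nat
  open import Data.Nat.Properties
  open import Data.Nat.Divisibility using (_∣_; divides; _∣?_; ∣-refl)
  open import Data.Nat.DivMod using (_/_; n/n≡1; m≡m%n+[m/n]*n)
  open import Data.Nat.Tactic.RingSolver using (solve-∀)
  open import Function using (id)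
  open import Data.Nat.Primality using (prime⇒nonTrivial; prime⇒irreducible)
  import Data.Integer.Properties as ℤ
  open import Data.Product using (∃; _,_)
  open import Data.Sum using ([_,_]′)
  open import Relation.Nullary using (yes; no)
  open import Relation.Binary.PropositionalEquality
  open import Defs using (OddNat; spfFrom; spf; jacobi; legendre; Step1Composite; Step2Composite)

  prime⇒2≤ : ∀ {p} → Prime p → 2 ≤ p
  prime⇒2≤ {p} p-prime = nonTrivial⇒n>1 p {{prime⇒nonTrivial p-prime}}

  prime⇒≢1 : ∀ {p} → Prime p → p ≢ 1
  prime⇒≢1 p-prime = nonTrivial⇒≢1 {{prime⇒nonTrivial p-prime}}

  n*n≰n : ∀ {n} → 2 ≤ n → ¬ n * n ≤ n
  n*n≰n {n} 2≤n n*n≤n =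
    <⇒≱ 2≤n (*-cancelˡ-≤ n {{>-nonZero (<-trans z<s 2≤n)}} (≤-trans n*n≤n (≤-reflexive (sym (*-identityʳ n)))))

  prime⇒¬step1 : ∀ {p} B → Prime p → ¬ Step1Composite B p
  prime⇒¬step1 B p-prime (q , q-prime , _ , q*q≤p , q∣p) =
    [ prime⇒≢1 q-prime
    , (λ q≡p → n*n≰n (prime⇒2≤ p-prime) (subst (λ q → q * q ≤ _) q≡p q*q≤p)) ]′
    (prime⇒irreducible p-prime q∣p)

  prime⇒¬step2 : ∀ {p} → Prime p → ¬ Step2Composite p
  prime⇒¬step2 p-prime (r , r*r≡p) =
    [ (λ r≡1 → prime⇒≢1 p-prime (trans (sym r*r≡p) (cong (λ r → r * r) r≡1)))
    , (λ r≡p → n*n≰n (prime⇒2≤ p-prime) (≤-reflexive (trans (cong (λ r → r * r) (sym r≡p)) r*r≡p))) ]′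
    (prime⇒irreducible p-prime (divides r (sym r*r≡p)))

  odd⇒≡1+m+m : ∀ {p} → OddNat p → ∃ λ m → p ≡ suc (m + m)
  odd⇒≡1+m+m {p} p-odd = p / 2 , trans (m≡m%n+[m/n]*n p 2) (trans (cong (_+ (p / 2) * 2) p-odd) (lemma (p / 2)))
    where
    lemma : ∀ m → 1 + m * 2 ≡ suc (m + m)
    lemma = solve-∀

  spfFrom-prime : ∀ {p} → Prime p → ∀ f d → 2 ≤ d → d ≤ p → p < d + f → spfFrom f d p ≡ p
  spfFrom-prime {p} p-prime zero d 2≤d d≤p p<d+0 = contradiction d≤p (<⇒≱ (subst (p <_) (+-identityʳ d) p<d+0))
  spfFrom-prime {p} p-prime (suc f) d 2≤d d≤p p<d+1+f with d ∣? p
  ... | yes d∣p =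
    [ (λ d≡1 → contradiction (subst (2 ≤_) d≡1 2≤d) (<-irrefl refl)) , id ]′ (prime⇒irreducible p-prime d∣p)
  ... | no  d∤p = spfFrom-prime p-prime f (suc d) (m≤n⇒m≤1+n 2≤d) d<p (subst (p <_) (+-suc d f) p<d+1+f)
    where
    d<p : d < p
    d<p = ≤∧≢⇒< d≤p (λ d≡p → d∤p (subst (_∣ p) (sym d≡p) ∣-refl))

  spf-prime : ∀ {p} → Prime p → spf p ≡ p
  spf-prime {p} p-prime = spfFrom-prime p-prime p 2 ≤-refl (prime⇒2≤ p-prime) (m<n+m p z<s)

  jacobi≡legendre : ∀ {p} a → Prime p → jacobi a p ≡ legendre a p
  jacobi≡legendre {suc (suc q)} a p-prime rewrite spf-prime p-prime | n/n≡1 (suc (suc q)) {{_}} = ℤ.*-identityʳ _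

open import Defs
open import Data.Nat using (ℕ; _≤_)
open import Data.Nat.Primality using (Prime)
open import Data.Integer using (ℤ; +_; -[1+_]; _+_; _*_; -_)
open import Relation.Binary.PropositionalEquality using (_≡_; refl; sym; trans)
open import Data.Product using (_,_)
open PrimeArithmetic
open LegendreSymbol

proposition2p1 : (B : ℕ) → 1 ≤ B → (p : ℕ) → Prime p → OddNat p →
                 (b c : ℤ) →
                 jacobi (b * b + + 4 * c) p ≡ -[1+ 0 ] →
                 jacobi (- c) p ≡ + 1 →
                 PassesQFT B p b c
proposition2p1 B _ p p-prime p-odd b c jacobi[D]≡-1 jacobi[-c]≡1 with odd⇒≡1+m+m {p} p-odd
... | m , refl with legendre≡1⇒unit-square (trans (sym (jacobi≡legendre (- c) p-prime)) jacobi[-c]≡1)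
...   | e , -c≡e*e , e≢0 =
  prime⇒¬step1 B p-prime , prime⇒¬step2 p-prime , ¬step3 -c≡e*e e≢0 , ¬step4 , ¬step5 -c≡e*e e≢0
  where
  open QuadraticFrobenius m p-prime b c
    (legendre≡-1⇒nonsquare (trans (sym (jacobi≡legendre (b * b + + 4 * c) p-prime)) jacobi[D]≡-1))
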